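{- Let $M$ be a matroid and $v\in\mathbb{F}_2^{r(M)}$. If $\chi(M_v)=k$, then there exists a linear subspace $H$ of $\mathbb{F}_2^{r(M)}$ of codimension $k$ with $v\in H$ and $|E(M)\cap H|\leq 2^{r(M)-k-1}$.
   Context: A matroid $M$ means a simple binary matroid, represented by an integer $r(M)\geq 0$ (its rank) and a set $E(M)\subseteq \mathbb{F}_2^{r(M)}\setminus\{0\}$ that spans $\mathbb{F}_2^{r(M)}$. For $v\in\mathbb{F}_2^{r(M)}$, $M_v$ is defined by $r(M_v)=r(M)$ and $E(M_v)=\{x: x\in E(M)\text{ and }x+v\in E(M)\}$. The critical number $\chi(M_v)$ is the smallest $k$ such that some subspace of $\mathbb{F}_2^{r(M)}$ of codimension $k$ is disjoint from $E(M_v)$. -}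

module Defs where

open import Data.Bool using (Bool; true; false; _∧_; _xor_; if_then_else_)
open import Data.Nat using (ℕ; zero; suc; _≤_; _∸_; _+_)
open import Data.Vec using (Vec; []; _∷_; replicate; zipWith)
open import Data.List using (List; []; _∷_; _++_; map)
open import Data.List.Relation.Unary.All using (All)
open import Data.Product using (Σ; _×_; ∃; _,_)
open import Relation.Binary.PropositionalEquality using (_≡_)
open import Function.Bundles using (_⇔_)

-- Vectors of F₂^n, with F₂ = Bool (false = 0, true = 1).
F₂^ : ℕ → Set
F₂^ n = Vec Bool n

𝟘 : ∀ {n} → F₂^ n
𝟘 = replicate _ false

infixl 6 _⊕_
_⊕_ : ∀ {n} → F₂^ n → F₂^ n → F₂^ n
_⊕_ = zipWith _xor_

sumV : ∀ {n} → List (F₂^ n) → F₂^ n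
sumV []       = 𝟘
sumV (x ∷ xs) = x ⊕ sumV xs

lincomb : ∀ {n d} → Vec (F₂^ n) d → Vec Bool d → F₂^ n
lincomb []       []       = 𝟘
lincomb (b ∷ bs) (c ∷ cs) = (if c then b else 𝟘) ⊕ lincomb bs cs

SubsetF : ℕ → Set
SubsetF n = F₂^ n → Bool

LinIndep : ∀ {n d} → Vec (F₂^ n) d → Set
LinIndep {d = d} B = ∀ c → lincomb B c ≡ 𝟘 → c ≡ replicate d false

IsSubspaceOfDim : (n : ℕ) → SubsetF n → ℕ → Set
IsSubspaceOfDim n H d =
  Σ (Vec (F₂^ n) d) λ B → LinIndep B ×
    (∀ x → (H x ≡ true) ⇔ (∃ λ c → lincomb B c ≡ x))

IsSubspaceOfCodim : (n : ℕ) → SubsetF n → ℕ → Set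
IsSubspaceOfCodim n H k = (k ≤ n) × IsSubspaceOfDim n H (n ∸ k)

-- Simple binary matroid of rank n with ground set E ⊆ F₂^n ∖ {0} spanning F₂^n.
IsSimpleBinaryMatroid : (n : ℕ) → SubsetF n → Set
IsSimpleBinaryMatroid n E =
  (E 𝟘 ≡ false) ×
  (∀ x → ∃ λ (xs : List (F₂^ n)) → All (λ y → E y ≡ true) xs × sumV xs ≡ x)

-- E(M_v) = { x ∈ E(M) : x + v ∈ E(M) }.
Ev : ∀ {n} → SubsetF n → F₂^ n → SubsetF n
Ev E v x = E x ∧ E (x ⊕ v)

Disjoint : ∀ {n} → SubsetF n → SubsetF n → Set
Disjoint A B = ∀ x → A x ≡ true → B x ≡ false

CriticalNumberIs : (n : ℕ) → SubsetF n → ℕ → Set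
CriticalNumberIs n S k =
  (∃ λ H → IsSubspaceOfCodim n H k × Disjoint H S) ×
  (∀ j → (∃ λ H → IsSubspaceOfCodim n H j × Disjoint H S) → k ≤ j)

allVecs : (n : ℕ) → List (F₂^ n)
allVecs zero    = [] ∷ []
allVecs (suc n) = map (false ∷_) (allVecs n) ++ map (true ∷_) (allVecs n)

countL : ∀ {n} → SubsetF n → List (F₂^ n) → ℕ
countL P []       = zero
countL P (x ∷ xs) = (if P x then 1 else 0) + countL P xs

card : ∀ {n} → SubsetF n → ℕ
card {n} P = countL P (allVecs n)

_∩_ : ∀ {n} → SubsetF n → SubsetF n → SubsetF n
(A ∩ B) x = A x ∧ B x

-- A subspace H of least codimension k avoiding E(M_v) must contain v: otherwise H + ⟨v⟩ has
-- codimension k - 1 and still avoids E(M_v), because E(M_v) is invariant under x ↦ x + v.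
-- Once v ∈ H, translation by v maps H into itself, and it sends E(M) ∩ H into H ∖ E(M), since
-- x, x + v ∈ E(M) would put x ∈ E(M_v) ∩ H. Hence E(M) ∩ H fills at most half of H, which has
-- 2^(r(M) - k) elements.
module Submission where

open import Defs
open import Data.Bool using (Bool; true; false; _∧_; _∨_; _xor_; not; if_then_else_)
open import Data.Bool.Properties
  using (xor-same; xor-comm; xor-assoc; xor-identityˡ; xor-identityʳ; ∧-comm; ∨-zeroʳ)
open import Data.Empty using (⊥; ⊥-elim)
open import Data.List using (List; []; _∷_; _++_; map)
open import Data.Nat using (ℕ; zero; suc; _≤_; _<_; _∸_; _*_; _^_; _+_; z≤n; s≤s)
open import Data.Nat.Properties
open import Data.Product using (_×_; ∃; _,_)
open import Data.Vec using (Vec; []; _∷_)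
open import Data.Vec.Properties
  using (∷-injectiveʳ; zipWith-assoc; zipWith-comm; zipWith-identityˡ; zipWith-identityʳ)
open import Function.Bundles using (_⇔_; mk⇔; Equivalence)
open import Relation.Binary.PropositionalEquality
open import Algebra.Properties.CommutativeSemigroup +-commutativeSemigroup
  using () renaming (interchange to +-interchange)

⊕-assoc : ∀ {n} (x y z : F₂^ n) → (x ⊕ y) ⊕ z ≡ x ⊕ (y ⊕ z)
⊕-assoc = zipWith-assoc xor-assoc

⊕-comm : ∀ {n} (x y : F₂^ n) → x ⊕ y ≡ y ⊕ x
⊕-comm = zipWith-comm xor-comm

⊕-identityˡ : ∀ {n} (x : F₂^ n) → 𝟘 ⊕ x ≡ x
⊕-identityˡ = zipWith-identityˡ xor-identityˡ

⊕-identityʳ : ∀ {n} (x : F₂^ n) → x ⊕ 𝟘 ≡ x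
⊕-identityʳ = zipWith-identityʳ xor-identityʳ

⊕-self : ∀ {n} (x : F₂^ n) → x ⊕ x ≡ 𝟘
⊕-self []      = refl
⊕-self (a ∷ x) = cong₂ _∷_ (xor-same a) (⊕-self x)

⊕-cancelʳ : ∀ {n} (x y : F₂^ n) → (x ⊕ y) ⊕ y ≡ x
⊕-cancelʳ x y = begin
  (x ⊕ y) ⊕ y  ≡⟨ ⊕-assoc x y y ⟩
  x ⊕ (y ⊕ y)  ≡⟨ cong (x ⊕_) (⊕-self y) ⟩
  x ⊕ 𝟘        ≡⟨ ⊕-identityʳ x ⟩
  x            ∎
  where open ≡-Reasoning

⊕-cancelˡ : ∀ {n} (x y : F₂^ n) → x ⊕ (x ⊕ y) ≡ y
⊕-cancelˡ x y = trans (⊕-comm x (x ⊕ y)) (trans (cong (_⊕ x) (⊕-comm x y)) (⊕-cancelʳ y x))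

⊕≡𝟘⇒≡ : ∀ {n} (x y : F₂^ n) → x ⊕ y ≡ 𝟘 → x ≡ y
⊕≡𝟘⇒≡ x y x⊕y≡𝟘 = begin
  x            ≡⟨ ⊕-cancelʳ x y ⟨
  (x ⊕ y) ⊕ y  ≡⟨ cong (_⊕ y) x⊕y≡𝟘 ⟩
  𝟘 ⊕ y        ≡⟨ ⊕-identityˡ y ⟩
  y            ∎
  where open ≡-Reasoning

⊕-interchange : ∀ {n} (w x y z : F₂^ n) → (w ⊕ x) ⊕ (y ⊕ z) ≡ (w ⊕ y) ⊕ (x ⊕ z)
⊕-interchange w x y z = begin
  (w ⊕ x) ⊕ (y ⊕ z)  ≡⟨ ⊕-assoc w x (y ⊕ z) ⟩
  w ⊕ (x ⊕ (y ⊕ z))  ≡⟨ cong (w ⊕_) (⊕-assoc x y z) ⟨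
  w ⊕ ((x ⊕ y) ⊕ z)  ≡⟨ cong (λ t → w ⊕ (t ⊕ z)) (⊕-comm x y) ⟩
  w ⊕ ((y ⊕ x) ⊕ z)  ≡⟨ cong (w ⊕_) (⊕-assoc y x z) ⟩
  w ⊕ (y ⊕ (x ⊕ z))  ≡⟨ ⊕-assoc w y (x ⊕ z) ⟨
  (w ⊕ y) ⊕ (x ⊕ z)  ∎
  where open ≡-Reasoning

scale-⊕ : ∀ {n} (b : F₂^ n) (c c′ : Bool) →
  (if c then b else 𝟘) ⊕ (if c′ then b else 𝟘) ≡ (if c xor c′ then b else 𝟘)
scale-⊕ b false false = ⊕-identityʳ 𝟘
scale-⊕ b false true  = ⊕-identityˡ b
scale-⊕ b true  false = ⊕-identityʳ b
scale-⊕ b true  true  = ⊕-self b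

lincomb-⊕ : ∀ {n d} (B : Vec (F₂^ n) d) (c c′ : Vec Bool d) →
  lincomb B c ⊕ lincomb B c′ ≡ lincomb B (c ⊕ c′)
lincomb-⊕ []      []      []        = ⊕-self 𝟘
lincomb-⊕ (b ∷ B) (x ∷ c) (y ∷ c′) =
  trans (⊕-interchange _ _ _ _) (cong₂ _⊕_ (scale-⊕ b x y) (lincomb-⊕ B c c′))

𝟙 : Bool → ℕ
𝟙 b = if b then 1 else 0

𝟙-mono : ∀ {a b} → (a ≡ true → b ≡ true) → 𝟙 a ≤ 𝟙 b
𝟙-mono {false} _   = z≤n
𝟙-mono {true}  a⇒b rewrite a⇒b refl = ≤-refl

𝟙-∨ : ∀ a b → (a ≡ true → b ≡ true → ⊥) → 𝟙 (a ∨ b) ≡ 𝟙 a + 𝟙 b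
𝟙-∨ false b     _ = refl
𝟙-∨ true  false _ = refl
𝟙-∨ true  true  ¬both = ⊥-elim (¬both refl refl)

module _ {n : ℕ} where

  countL-cong : {P Q : SubsetF n} → (∀ x → P x ≡ Q x) → ∀ L → countL P L ≡ countL Q L
  countL-cong P≗Q []      = refl
  countL-cong P≗Q (x ∷ L) = cong₂ _+_ (cong 𝟙 (P≗Q x)) (countL-cong P≗Q L)

  countL-mono : {P Q : SubsetF n} → (∀ x → P x ≡ true → Q x ≡ true) →
    ∀ L → countL P L ≤ countL Q L
  countL-mono P⊆Q []      = z≤n
  countL-mono P⊆Q (x ∷ L) = +-mono-≤ (𝟙-mono (P⊆Q x)) (countL-mono P⊆Q L)

  countL-+ : {P Q R : SubsetF n} → (∀ x → 𝟙 (P x) ≡ 𝟙 (Q x) + 𝟙 (R x)) →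
    ∀ L → countL P L ≡ countL Q L + countL R L
  countL-+ split []      = refl
  countL-+ {Q = Q} {R} split (x ∷ L) = trans
    (cong₂ _+_ (split x) (countL-+ split L))
    (+-interchange (𝟙 (Q x)) (𝟙 (R x)) (countL Q L) (countL R L))

  countL-++ : (P : SubsetF n) (xs ys : List (F₂^ n)) →
    countL P (xs ++ ys) ≡ countL P xs + countL P ys
  countL-++ P []       ys = refl
  countL-++ P (x ∷ xs) ys =
    trans (cong (𝟙 (P x) +_) (countL-++ P xs ys)) (sym (+-assoc (𝟙 (P x)) _ _))

countL-map : ∀ {m n} (P : SubsetF n) (f : F₂^ m → F₂^ n) (xs : List (F₂^ m)) →
  countL P (map f xs) ≡ countL (λ x → P (f x)) xs
countL-map P f []       = refl
countL-map P f (x ∷ xs) = cong (𝟙 (P (f x)) +_) (countL-map P f xs)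

card-suc : ∀ {n} (P : SubsetF (suc n)) →
  card P ≡ card (λ x → P (false ∷ x)) + card (λ x → P (true ∷ x))
card-suc {n} P = trans
  (countL-++ P (map (false ∷_) (allVecs n)) (map (true ∷_) (allVecs n)))
  (cong₂ _+_ (countL-map P (false ∷_) (allVecs n)) (countL-map P (true ∷_) (allVecs n)))

card-translate : ∀ {n} (P : SubsetF n) (v : F₂^ n) → card (λ x → P (x ⊕ v)) ≡ card P
card-translate {zero}  P []          = refl
card-translate {suc n} P (false ∷ v) = begin
  card (λ x → P (x ⊕ (false ∷ v)))
    ≡⟨ card-suc (λ x → P (x ⊕ (false ∷ v))) ⟩
  card (λ x → P (false ∷ (x ⊕ v))) + card (λ x → P (true ∷ (x ⊕ v)))
    ≡⟨ cong₂ _+_ (card-translate (λ x → P (false ∷ x)) v) (card-translate (λ x → P (true ∷ x)) v) ⟩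
  card (λ x → P (false ∷ x)) + card (λ x → P (true ∷ x))
    ≡⟨ card-suc P ⟨
  card P ∎
  where open ≡-Reasoning
card-translate {suc n} P (true ∷ v) = begin
  card (λ x → P (x ⊕ (true ∷ v)))
    ≡⟨ card-suc (λ x → P (x ⊕ (true ∷ v))) ⟩
  card (λ x → P (true ∷ (x ⊕ v))) + card (λ x → P (false ∷ (x ⊕ v)))
    ≡⟨ cong₂ _+_ (card-translate (λ x → P (true ∷ x)) v) (card-translate (λ x → P (false ∷ x)) v) ⟩
  card (λ x → P (true ∷ x)) + card (λ x → P (false ∷ x))
    ≡⟨ +-comm (card (λ x → P (true ∷ x))) _ ⟩
  card (λ x → P (false ∷ x)) + card (λ x → P (true ∷ x))
    ≡⟨ card-suc P ⟨
  card P ∎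
  where open ≡-Reasoning

card-mono-translate : ∀ {n} (P Q : SubsetF n) (v : F₂^ n) →
  (∀ x → P x ≡ true → Q (x ⊕ v) ≡ true) → card P ≤ card Q
card-mono-translate {n} P Q v P+v⊆Q =
  ≤-trans (countL-mono P+v⊆Q (allVecs n)) (≤-reflexive (card-translate Q v))

card-full : ∀ n → card {n} (λ _ → true) ≡ 2 ^ n
card-full zero    = refl
card-full (suc n) = begin
  card {suc n} (λ _ → true)  ≡⟨ card-suc {n} (λ _ → true) ⟩
  card {n} (λ _ → true) + card {n} (λ _ → true)  ≡⟨ cong₂ _+_ (card-full n) (card-full n) ⟩
  2 ^ n + 2 ^ n  ≡⟨ cong (2 ^ n +_) (+-identityʳ (2 ^ n)) ⟨
  2 ^ suc n      ∎
  where open ≡-Reasoning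

card≤2^n : ∀ {n} (P : SubsetF n) → card P ≤ 2 ^ n
card≤2^n {n} P = ≤-trans (countL-mono (λ _ _ → refl) (allVecs n)) (≤-reflexive (card-full n))

is𝟘 : ∀ {n} → SubsetF n
is𝟘 []      = true
is𝟘 (a ∷ x) = not a ∧ is𝟘 x

is𝟘-𝟘 : ∀ n → is𝟘 (𝟘 {n}) ≡ true
is𝟘-𝟘 zero    = refl
is𝟘-𝟘 (suc n) = is𝟘-𝟘 n

is𝟘⇒≡𝟘 : ∀ {n} (x : F₂^ n) → is𝟘 x ≡ true → x ≡ 𝟘
is𝟘⇒≡𝟘 []          _       = refl
is𝟘⇒≡𝟘 (false ∷ x) x≡𝟘 = cong (false ∷_) (is𝟘⇒≡𝟘 x x≡𝟘)

card-is𝟘 : ∀ n → card (is𝟘 {n}) ≡ 1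
card-is𝟘 zero    = refl
card-is𝟘 (suc n) = trans (card-suc {n} is𝟘) (cong₂ _+_ (card-is𝟘 n) (none (allVecs n)))
  where
  none : (L : List (F₂^ n)) → countL (λ _ → false) L ≡ 0
  none []      = refl
  none (_ ∷ L) = none L

-- For a subspace S, S ⊞ v is the span of S and v.
infixl 6 _⊞_
_⊞_ : ∀ {n} → SubsetF n → F₂^ n → SubsetF n
(S ⊞ v) x = S x ∨ S (x ⊕ v)

span : ∀ {n d} → Vec (F₂^ n) d → SubsetF n
span []      = is𝟘
span (b ∷ B) = span B ⊞ b

lincomb∈span : ∀ {n d} (B : Vec (F₂^ n) d) (c : Vec Bool d) → span B (lincomb B c) ≡ true
lincomb∈span {n} []      []          = is𝟘-𝟘 n
lincomb∈span     (b ∷ B) (false ∷ c)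
  rewrite ⊕-identityˡ (lincomb B c) | lincomb∈span B c = refl
lincomb∈span     (b ∷ B) (true ∷ c)
  rewrite ⊕-comm (b ⊕ lincomb B c) b | ⊕-cancelˡ b (lincomb B c) | lincomb∈span B c =
  ∨-zeroʳ _

span⇒lincomb : ∀ {n d} (B : Vec (F₂^ n) d) (x : F₂^ n) →
  span B x ≡ true → ∃ λ c → lincomb B c ≡ x
span⇒lincomb []      x x∈span = [] , sym (is𝟘⇒≡𝟘 x x∈span)
span⇒lincomb (b ∷ B) x x∈span with span B x in x∈B
... | true  = let (c , c↦x) = span⇒lincomb B x x∈B
              in false ∷ c , trans (⊕-identityˡ _) c↦x
... | false = let (c , c↦x+b) = span⇒lincomb B (x ⊕ b) x∈span
              in true ∷ c , trans (cong (b ⊕_) c↦x+b) (trans (⊕-comm b (x ⊕ b)) (⊕-cancelʳ x b))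

span-⊕ : ∀ {n d} (B : Vec (F₂^ n) d) {x y : F₂^ n} →
  span B x ≡ true → span B y ≡ true → span B (x ⊕ y) ≡ true
span-⊕ B {x} {y} x∈B y∈B with span⇒lincomb B x x∈B | span⇒lincomb B y y∈B
... | c , refl | c′ , refl = subst (λ z → span B z ≡ true) (sym (lincomb-⊕ B c c′)) (lincomb∈span B _)

LinIndep-∷⁻ : ∀ {n d} {b : F₂^ n} {B : Vec (F₂^ n) d} → LinIndep (b ∷ B) → LinIndep B
LinIndep-∷⁻ indep c c↦𝟘 = ∷-injectiveʳ (indep (false ∷ c) (trans (⊕-identityˡ _) c↦𝟘))

LinIndep⇒∉span : ∀ {n d} (b : F₂^ n) (B : Vec (F₂^ n) d) → LinIndep (b ∷ B) →
  span B b ≡ true → ⊥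
LinIndep⇒∉span b B indep b∈B with span⇒lincomb B b b∈B
... | c , c↦b with indep (true ∷ c) (trans (cong (b ⊕_) c↦b) (⊕-self b))
...   | ()

LinIndep-∷ : ∀ {n d} {v : F₂^ n} {B : Vec (F₂^ n) d} → LinIndep B → span B v ≡ false →
  LinIndep (v ∷ B)
LinIndep-∷ indep v∉B (false ∷ c) c↦𝟘 =
  cong (false ∷_) (indep c (trans (sym (⊕-identityˡ _)) c↦𝟘))
LinIndep-∷ {v = v} {B} indep v∉B (true ∷ c) v+c↦𝟘
  with trans (sym v∉B) (subst (λ z → span B z ≡ true) (sym (⊕≡𝟘⇒≡ v _ v+c↦𝟘)) (lincomb∈span B c))
... | ()

card-⊞ : ∀ {n} (S : SubsetF n) (v : F₂^ n) →
  (∀ x → S x ≡ true → S (x ⊕ v) ≡ true → ⊥) → card (S ⊞ v) ≡ card S + card S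
card-⊞ {n} S v disjoint = begin
  card (S ⊞ v)                       ≡⟨ countL-+ (λ x → 𝟙-∨ (S x) _ (disjoint x)) (allVecs n) ⟩
  card S + card (λ x → S (x ⊕ v))    ≡⟨ cong (card S +_) (card-translate S v) ⟩
  card S + card S                    ∎
  where open ≡-Reasoning

card-span : ∀ {n d} (B : Vec (F₂^ n) d) → LinIndep B → card (span B) ≡ 2 ^ d
card-span {n} []          _     = card-is𝟘 n
card-span {d = suc d} (b ∷ B) indep = begin
  card (span B ⊞ b)              ≡⟨ card-⊞ (span B) b b∉B+B ⟩
  card (span B) + card (span B)  ≡⟨ cong₂ _+_ IH IH ⟩
  2 ^ d + 2 ^ d                  ≡⟨ cong (2 ^ d +_) (+-identityʳ (2 ^ d)) ⟨
  2 ^ suc d                      ∎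
  where
  open ≡-Reasoning
  IH = card-span B (LinIndep-∷⁻ indep)
  b∉B+B : ∀ x → span B x ≡ true → span B (x ⊕ b) ≡ true → ⊥
  b∉B+B x x∈B x+b∈B =
    LinIndep⇒∉span b B indep (subst (λ z → span B z ≡ true) (⊕-cancelˡ x b) (span-⊕ B x∈B x+b∈B))

≡true-⇔⇒≡ : ∀ {a b} → (a ≡ true → b ≡ true) → (b ≡ true → a ≡ true) → a ≡ b
≡true-⇔⇒≡ {false} {false} _   _   = refl
≡true-⇔⇒≡ {false} {true}  _   b⇒a = b⇒a refl
≡true-⇔⇒≡ {true}  {false} a⇒b _   = sym (a⇒b refl)
≡true-⇔⇒≡ {true}  {true}  _   _   = refl

module _ {n d : ℕ} {H : SubsetF n} (H-dim : IsSubspaceOfDim n H d) where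

  private
    B = let (B , _ , _) = H-dim in B

  subspace≗span : ∀ x → H x ≡ span B x
  subspace≗span x = let (_ , _ , H⇔) = H-dim in ≡true-⇔⇒≡
    (λ x∈H → let (c , c↦x) = Equivalence.to (H⇔ x) x∈H
             in subst (λ z → span B z ≡ true) c↦x (lincomb∈span B c))
    (λ x∈B → Equivalence.from (H⇔ x) (span⇒lincomb B x x∈B))

  subspace-⊕ : ∀ {x y} → H x ≡ true → H y ≡ true → H (x ⊕ y) ≡ true
  subspace-⊕ {x} {y} x∈H y∈H = trans (subspace≗span (x ⊕ y))
    (span-⊕ B (trans (sym (subspace≗span x)) x∈H) (trans (sym (subspace≗span y)) y∈H))

  card-subspace : card H ≡ 2 ^ d
  card-subspace = let (_ , indep , _) = H-dim in
    trans (countL-cong subspace≗span (allVecs n)) (card-span B indep)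

  dim≤rank : d ≤ n
  dim≤rank = ≮⇒≥ λ n<d → <⇒≱ (^-monoʳ-< 2 (s≤s (s≤s z≤n)) n<d)
    (subst (_≤ 2 ^ n) card-subspace (card≤2^n H))

  ⊞-subspace : (v : F₂^ n) → H v ≡ false → IsSubspaceOfDim n (H ⊞ v) (suc d)
  ⊞-subspace v v∉H = let (_ , indep , _) = H-dim in
    v ∷ B , LinIndep-∷ indep (trans (sym (subspace≗span v)) v∉H) , λ x →
      let B⊞v⇔ = mk⇔ (span⇒lincomb (v ∷ B) x) (λ { (c , refl) → lincomb∈span (v ∷ B) c })
      in subst (λ b → (b ≡ true) ⇔ (∃ λ c → lincomb (v ∷ B) c ≡ x))
           (sym (cong₂ _∨_ (subspace≗span x) (subspace≗span (x ⊕ v)))) B⊞v⇔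

smaller-codim : ∀ {n k} {H : SubsetF n} → k ≤ n → IsSubspaceOfDim n H (suc (n ∸ k)) →
  ∃ λ k′ → k′ < k × IsSubspaceOfCodim n H k′
smaller-codim {k = zero}  _   H-dim = ⊥-elim (1+n≰n (dim≤rank H-dim))
smaller-codim {k = suc k} k<n H-dim =
  k , ≤-refl , <⇒≤ k<n , subst (IsSubspaceOfDim _ _) (sym (+-∸-assoc 1 k<n)) H-dim

Ev-⊕-invariant : ∀ {n} (E : SubsetF n) (v x : F₂^ n) → Ev E v (x ⊕ v) ≡ Ev E v x
Ev-⊕-invariant E v x rewrite ⊕-cancelʳ x v = ∧-comm (E (x ⊕ v)) (E x)

⊞-disjoint : ∀ {n} {H S : SubsetF n} (v : F₂^ n) → (∀ x → S (x ⊕ v) ≡ S x) →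
  Disjoint H S → Disjoint (H ⊞ v) S
⊞-disjoint {H = H} v S-invariant H∩S=∅ x x∈H⊞v with H x in x∈H
... | true  = H∩S=∅ x x∈H
... | false = trans (sym (S-invariant x)) (H∩S=∅ (x ⊕ v) x∈H⊞v)

card-∩-half : ∀ {n} (E H : SubsetF n) (v : F₂^ n) →
  (∀ x → H x ≡ true → H (x ⊕ v) ≡ true) → Disjoint H (Ev E v) → 2 * card (E ∩ H) ≤ card H
card-∩-half {n} E H v H+v⊆H H∩Ev=∅ = begin
  2 * card (E ∩ H)              ≡⟨ cong (card (E ∩ H) +_) (+-identityʳ _) ⟩
  card (E ∩ H) + card (E ∩ H)   ≤⟨ +-monoʳ-≤ (card (E ∩ H)) (card-mono-translate _ _ v shift) ⟩
  card (E ∩ H) + card (H∖E)     ≡⟨ countL-+ (λ x → split (E x) (H x)) (allVecs n) ⟨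
  card H                        ∎
  where
  open ≤-Reasoning
  H∖E : SubsetF n
  H∖E x = not (E x) ∧ H x
  split : ∀ e h → 𝟙 h ≡ 𝟙 (e ∧ h) + 𝟙 (not e ∧ h)
  split false h     = refl
  split true  false = refl
  split true  true  = refl
  shift : ∀ x → (E ∩ H) x ≡ true → H∖E (x ⊕ v) ≡ true
  shift x x∈E∩H with E x in x∈E | H x in x∈H
  ... | true | true
    rewrite subst (λ e → e ∧ E (x ⊕ v) ≡ false) x∈E (H∩Ev=∅ x x∈H) | H+v⊆H x x∈H = refl

proposition2p6 : (n : ℕ) (E : SubsetF n) → IsSimpleBinaryMatroid n E →
    (v : F₂^ n) (k : ℕ) → CriticalNumberIs n (Ev E v) k →
    ∃ λ (H : SubsetF n) → IsSubspaceOfCodim n H k × H v ≡ true ×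
    2 * card (E ∩ H) ≤ 2 ^ (n ∸ k)
proposition2p6 n E _ v k ((H , (k≤n , H-dim) , H∩Ev=∅) , minimal) with H v in v∈H
... | true = H , (k≤n , H-dim) , v∈H , (begin
  2 * card (E ∩ H)  ≤⟨ card-∩-half E H v (λ x x∈H → subspace-⊕ H-dim x∈H v∈H) H∩Ev=∅ ⟩
  card H            ≡⟨ card-subspace H-dim ⟩
  2 ^ (n ∸ k)       ∎)
  where open ≤-Reasoning
... | false with smaller-codim k≤n (⊞-subspace H-dim v v∈H)
...   | k′ , k′<k , H⊞v-codim = ⊥-elim (<⇒≱ k′<k
  (minimal k′ (H ⊞ v , H⊞v-codim , ⊞-disjoint v (Ev-⊕-invariant E v) H∩Ev=∅)))
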